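{- Let $n = 2^m$ with $m \geq 2$. Let $G = \{A \subseteq \{1, \dots, n-1\} : |A| \text{ even}\}$, a group under symmetric difference $\Delta$, and let $H$ be the subgroup of $G$ generated by $$\mathsf K = \{\{j, 2^{i-1}+j\} : j = 1, 2, \dots, 2^{i-1}-1,\ i = 2, 3, \dots, m\}.$$ Then: (1) no nonempty element of $H$ is a set of consecutive integers, and $|H| = 2^{n-m-1}$; (2) the sets $H_1 = H$ and $H_i = \{1, 2, \dots, 2i-2\} \,\Delta\, H = \{\{1,\dots,2i-2\}\Delta B : B \in H\}$ for $i = 2, \dots, n/2$ are pairwise distinct and are precisely all the cosets of $H$ in $G$.
   Context: $\Delta$ denotes symmetric difference of sets. -}

module Defs where

open import Data.Nat using (ℕ; zero; suc; _+_; _*_; _∸_; _^_; _≤_; _/_; _%_; _≤ᵇ_; _≡ᵇ_)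
open import Data.Bool using (Bool; true; false; _∧_; _∨_; _xor_)
open import Data.Fin using (Fin; toℕ)
open import Data.Fin.Subset using (Subset; ∣_∣; ⊥)
open import Data.Vec using (tabulate; zipWith)
open import Data.Product using (Σ; ∃; _×_; _,_)
open import Data.List using (List; length)
open import Data.List.Relation.Unary.Unique.Propositional using (Unique)
import Data.List.Membership.Propositional as LMem
open import Relation.Binary.PropositionalEquality using (_≡_)

-- n = 2^m ; the ground set {1, ..., n-1} has N = n - 1 elements.
-- A subset of {1,...,n-1} is a Subset N, where index k : Fin N stands for the integer toℕ k + 1.
nOf : ℕ → ℕ
nOf m = 2 ^ m

Ground : ℕ → Set
Ground m = Subset (nOf m ∸ 1)

module _ (m : ℕ) where

  val : Fin (nOf m ∸ 1) → ℕ
  val k = suc (toℕ k)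

  infixl 6 _Δ_
  _Δ_ : Ground m → Ground m → Ground m
  A Δ B = zipWith _xor_ A B

  ∅ : Ground m
  ∅ = ⊥

  interval : ℕ → ℕ → Ground m
  interval a b = tabulate (λ k → (a ≤ᵇ val k) ∧ (val k ≤ᵇ b))

  pair : ℕ → ℕ → Ground m
  pair a b = tabulate (λ k → (val k ≡ᵇ a) ∨ (val k ≡ᵇ b))

  InG : Ground m → Set
  InG A = ∣ A ∣ % 2 ≡ 0

  InK : Ground m → Set
  InK B = Σ ℕ λ i → Σ ℕ λ j →
            (2 ≤ i) × (i ≤ m) × (1 ≤ j) × (j ≤ 2 ^ (i ∸ 1) ∸ 1) ×
            (B ≡ pair j (2 ^ (i ∸ 1) + j))

  -- subgroup generated by K in the Boolean group (Ground m, Δ):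
  -- every element is its own inverse, so closure under ∅ and Δ suffices.
  data InH : Ground m → Set where
    H-∅   : InH ∅
    H-gen : ∀ {B} → InK B → InH B
    H-Δ   : ∀ {A B} → InH A → InH B → InH (A Δ B)

  Coset : Ground m → Ground m → Set
  Coset c B = Σ (Ground m) λ h → InH h × (B ≡ c Δ h)

  Hi : ℕ → Ground m → Set
  Hi zero          = Coset ∅           -- unused (i ranges over 1..n/2)
  Hi (suc zero)    = InH
  Hi (suc (suc k)) = Coset (interval 1 (2 * suc k))

  SameSet : (Ground m → Set) → (Ground m → Set) → Set
  SameSet P Q = ∀ B → (P B → Q B) × (Q B → P B)

  HasCard : (Ground m → Set) → ℕ → Set
  HasCard P c = Σ (List (Ground m)) λ L →
                  Unique L × (∀ B → (B LMem.∈ L → P B) × (P B → B LMem.∈ L)) × (length L ≡ c)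

-- Write P = 2^m.  The generators of H_{m+1} are those of H_m together with the pairs {j, P + j}, and
-- folding B ⊆ [1, 2P) onto (B ∩ [1, P)) Δ ((B ∩ (P, 2P)) - P) sends these pairs to ∅; hence
-- B ∈ H_{m+1} iff P ∉ B and the fold of B lies in H_m.  Everything follows from this recursion.
-- An interval containing P is not in H, and one avoiding P folds to an interval one level down.
-- B ↦ (upper half of B, fold of B) is a bijection from H_{m+1} onto 2^[1,P) × H_m, so
-- |H_{m+1}| = 2^(P-1) |H_m|.  The sets {1..2i} Δ {1..2j} are nonempty intervals, so the H_i are
-- distinct; and since parity is also computed by folding, an even set is moved into H by some
-- prefix {1..2k}, found by solving the folded problem.
module Submission where

open import Defs
open import Algebra.Bundles using (CommutativeMonoid; CommutativeRing)
open import Data.Bool using (Bool; true; false; not; _∧_; _∨_; _xor_; T; if_then_else_)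
open import Data.Bool.Properties
  using ( xor-assoc; xor-comm; xor-same; xor-identityʳ; ∨-identityʳ; ∧-zeroʳ; ∧-identityʳ
        ; xor-∧-commutativeRing)
open import Data.Empty using (⊥; ⊥-elim)
open import Data.Fin using (toℕ)
open import Data.Fin.Subset using (∣_∣)
open import Data.Fin.Subset.Properties using (∣⊥∣≡0)
open import Data.List using (List; []; _∷_; length; map; cartesianProductWith)
open import Data.List.Membership.Propositional using (_∈_)
open import Data.List.Membership.Propositional.Properties
  using (∈-cartesianProductWith⁺; ∈-cartesianProductWith⁻)
open import Data.List.Properties using (length-map; length-++)
open import Data.List.Relation.Unary.All using ([]; _∷_)
open import Data.List.Relation.Unary.AllPairs using ([]; _∷_)
open import Data.List.Relation.Unary.Any using (here; there)
open import Data.List.Relation.Unary.Unique.Propositional using (Unique)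
open import Data.List.Relation.Unary.Unique.Propositional.Properties using (cartesianProductWith⁺)
open import Data.Nat
  using ( ℕ; zero; suc; _+_; _*_; _∸_; _^_; _⊔_; _/_; _%_; _≤_; _<_; _≰_; _≮_; _≤ᵇ_; _<ᵇ_; _≡ᵇ_
        ; z≤n; s≤s; s≤s⁻¹; _≤?_; _<?_; >-nonZero)
open import Data.Nat.DivMod using ([m+kn]%n≡m%n; m*n%n≡0; m*n/n≡m; m/n*n≤m)
open import Data.Nat.Properties
open import Data.Product using (Σ; _×_; _,_; proj₁; swap)
open import Data.Sum using (inj₁; inj₂)
open import Data.Unit using (⊤; tt)
open import Data.Vec using (Vec; []; _∷_; tabulate; zipWith; replicate)
open import Data.Vec.Properties using (∷-injective)
open import Function using (_∘_)
open import Relation.Binary.Definitions using (tri<; tri≈; tri>)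
open import Relation.Binary.PropositionalEquality
open import Relation.Nullary using (¬_; yes; no)

open import Algebra.Properties.CommutativeSemigroup
  (CommutativeMonoid.commutativeSemigroup
    (CommutativeRing.+-commutativeMonoid xor-∧-commutativeRing))
  using () renaming (interchange to xor-interchange; x∙yz≈y∙xz to xor-left-comm)

private variable
  a b j k m n x y : ℕ

true≢false : true ≢ false
true≢false ()

T⇒≡true : ∀ {c} → T c → c ≡ true
T⇒≡true {true} _ = refl

¬T⇒≡false : ∀ {c} → ¬ T c → c ≡ false
¬T⇒≡false {false} _ = refl
¬T⇒≡false {true} ¬t = ⊥-elim (¬t tt)

≤ᵇ-true : m ≤ n → (m ≤ᵇ n) ≡ true
≤ᵇ-true = T⇒≡true ∘ ≤⇒≤ᵇ

≤ᵇ-false : m ≰ n → (m ≤ᵇ n) ≡ false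
≤ᵇ-false {m} {n} m≰n = ¬T⇒≡false (m≰n ∘ ≤ᵇ⇒≤ m n)

<ᵇ-true : m < n → (m <ᵇ n) ≡ true
<ᵇ-true = T⇒≡true ∘ <⇒<ᵇ

<ᵇ-false : m ≮ n → (m <ᵇ n) ≡ false
<ᵇ-false {m} {n} m≮n = ¬T⇒≡false (m≮n ∘ <ᵇ⇒< m n)

≡ᵇ-true : m ≡ n → (m ≡ᵇ n) ≡ true
≡ᵇ-true {m} {n} = T⇒≡true ∘ ≡⇒≡ᵇ m n

≡ᵇ-false : m ≢ n → (m ≡ᵇ n) ≡ false
≡ᵇ-false {m} {n} m≢n = ¬T⇒≡false (m≢n ∘ ≡ᵇ⇒≡ m n)

+-cancelˡ-≡ᵇ : ∀ n a b → (n + a ≡ᵇ n + b) ≡ (a ≡ᵇ b)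
+-cancelˡ-≡ᵇ zero    a b = refl
+-cancelˡ-≡ᵇ (suc n) a b = +-cancelˡ-≡ᵇ n a b

xor-cancelʳ : ∀ p q → (p xor q) xor q ≡ p
xor-cancelʳ p q = trans (xor-assoc p q q) (trans (cong (p xor_) (xor-same q)) (xor-identityʳ p))

xor-cancelˡ : ∀ p q → p xor (p xor q) ≡ q
xor-cancelˡ p q = trans (sym (xor-assoc p p q)) (cong (_xor q) (xor-same p))

xor-cancel-middle : ∀ p q r → (p xor q) xor (p xor r) ≡ q xor r
xor-cancel-middle p q r = trans (xor-interchange p q p r) (cong (_xor (q xor r)) (xor-same p))

2^-suc : ∀ k → 2 ^ suc k ≡ 2 ^ k + 2 ^ k
2^-suc k = cong (2 ^ k +_) (+-identityʳ (2 ^ k))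

2^>0 : ∀ k → 0 < 2 ^ k
2^>0 = m^n>0 2

2^<2^suc : ∀ k → 2 ^ k < 2 ^ suc k
2^<2^suc k = subst (2 ^ k <_) (sym (2^-suc k)) (m<m+n (2 ^ k) (2^>0 k))

+-<-2^suc : ∀ k → x < 2 ^ k → 2 ^ k + x < 2 ^ suc k
+-<-2^suc {x} k x<2^k = subst (2 ^ k + x <_) (sym (2^-suc k)) (+-monoʳ-< (2 ^ k) x<2^k)

<⇒≤∸1 : m < n → m ≤ n ∸ 1
<⇒≤∸1 {m} {n} m<n = subst (m ≤_) (pred[m∸n]≡m∸[1+n] n 0) (<⇒≤pred m<n)

≤∸1⇒< : 0 < n → m ≤ n ∸ 1 → m < n
≤∸1⇒< {suc n} _ m≤n = s≤s m≤n

-- As in Defs.val, entry k of a vector stands for the integer k + 1; in particular χ v 0 = false.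
χ : Vec Bool n → ℕ → Bool
χ []      _             = false
χ (b ∷ v) zero          = false
χ (b ∷ v) (suc zero)    = b
χ (b ∷ v) (suc (suc x)) = χ v (suc x)

setOf : ∀ m → (ℕ → Bool) → Ground m
setOf m f = tabulate (λ k → f (suc (toℕ k)))

Agree : ℕ → (ℕ → Bool) → (ℕ → Bool) → Set
Agree m f g = ∀ x → 0 < x → x < 2 ^ m → f x ≡ g x

Agree-trans : ∀ m {f g h} → Agree m f g → Agree m g h → Agree m f h
Agree-trans m fg gh x 0<x x<2^m = trans (fg x 0<x x<2^m) (gh x 0<x x<2^m)

Agree-sym : ∀ m {f g} → Agree m f g → Agree m g f
Agree-sym m fg x 0<x x<2^m = sym (fg x 0<x x<2^m)

χ-zero : (v : Vec Bool n) → χ v 0 ≡ false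
χ-zero []      = refl
χ-zero (_ ∷ _) = refl

χ-tabulate : ∀ (f : ℕ → Bool) → y < n →
  χ (tabulate {n = n} (λ k → f (suc (toℕ k)))) (suc y) ≡ f (suc y)
χ-tabulate {zero}  {suc n} f _       = refl
χ-tabulate {suc y} {suc n} f (s≤s y<n) = χ-tabulate (f ∘ suc) y<n

χ-setOf : ∀ m f → Agree m (χ (setOf m f)) f
χ-setOf m f (suc y) _ y<2^m = χ-tabulate f (<⇒≤∸1 y<2^m)

χ-injectiveᵛ : (v w : Vec Bool n) → (∀ y → y < n → χ v (suc y) ≡ χ w (suc y)) → v ≡ w
χ-injectiveᵛ []      []      _  = refl
χ-injectiveᵛ (p ∷ v) (q ∷ w) eq =
  cong₂ _∷_ (eq 0 (s≤s z≤n)) (χ-injectiveᵛ v w (λ y y<n → eq (suc y) (s≤s y<n)))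

χ-injective : ∀ m (A B : Ground m) → Agree m (χ A) (χ B) → A ≡ B
χ-injective m A B eq = χ-injectiveᵛ A B (λ y y<n → eq (suc y) (s≤s z≤n) (≤∸1⇒< (2^>0 m) y<n))

χ-Δ : ∀ m (A B : Ground m) x → χ (_Δ_ m A B) x ≡ χ A x xor χ B x
χ-Δ m = go
  where
    go : (v w : Vec Bool n) → ∀ x → χ (zipWith _xor_ v w) x ≡ χ v x xor χ w x
    go []      []      x             = refl
    go (p ∷ v) (q ∷ w) zero          = refl
    go (p ∷ v) (q ∷ w) (suc zero)    = refl
    go (p ∷ v) (q ∷ w) (suc (suc x)) = go v w (suc x)

χ-∅ : ∀ m x → χ (∅ m) x ≡ false
χ-∅ m = go (2 ^ m ∸ 1)
  where
    go : ∀ n x → χ (replicate n false) x ≡ false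
    go zero    x             = refl
    go (suc n) zero          = refl
    go (suc n) (suc zero)    = refl
    go (suc n) (suc (suc x)) = go n (suc x)

setOf-cong : ∀ m {f g} → Agree m f g → setOf m f ≡ setOf m g
setOf-cong m {f} {g} fg =
  χ-injective m _ _ (Agree-trans m (χ-setOf m f) (Agree-trans m fg (Agree-sym m (χ-setOf m g))))

setOf-false : ∀ m → setOf m (λ _ → false) ≡ ∅ m
setOf-false m = χ-injective m _ _ (Agree-trans m (χ-setOf m _) (λ x _ _ → sym (χ-∅ m x)))

setOf-xor : ∀ m f g → setOf m (λ x → f x xor g x) ≡ _Δ_ m (setOf m f) (setOf m g)
setOf-xor m f g = χ-injective m _ _ λ x 0<x x<2^m →
  trans (χ-setOf m (λ y → f y xor g y) x 0<x x<2^m)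
        (sym (trans (χ-Δ m (setOf m f) (setOf m g) x)
                    (cong₂ _xor_ (χ-setOf m f x 0<x x<2^m) (χ-setOf m g x 0<x x<2^m))))

setOf-χ : ∀ m (A : Ground m) → setOf m (χ A) ≡ A
setOf-χ m A = χ-injective m _ _ (χ-setOf m (χ A))

fold : ℕ → (ℕ → Bool) → ℕ → Bool
fold k f x = f x xor f (2 ^ k + x)

fold-cong : ∀ m {f g} → Agree (suc m) f g → Agree m (fold m f) (fold m g)
fold-cong m fg x 0<x x<2^m = cong₂ _xor_ (fg x 0<x (<-trans x<2^m (2^<2^suc m)))
  (fg (2 ^ m + x) (<-≤-trans 0<x (m≤n+m x (2 ^ m))) (+-<-2^suc m x<2^m))

fold-xor : ∀ k f g x → fold k (λ y → f y xor g y) x ≡ fold k f x xor fold k g x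
fold-xor k f g x = xor-interchange (f x) (g x) (f (2 ^ k + x)) (g (2 ^ k + x))

fold-vanishing : ∀ k f → (∀ y → 2 ^ k ≤ y → f y ≡ false) → ∀ x → fold k f x ≡ f x
fold-vanishing k f f≥2^k x = trans (cong (f x xor_) (f≥2^k _ (m≤m+n (2 ^ k) x))) (xor-identityʳ (f x))

InHᶠ : ℕ → (ℕ → Bool) → Set
InHᶠ zero    f = ⊤
InHᶠ (suc m) f = f (2 ^ m) ≡ false × InHᶠ m (fold m f)

InHᶠ-cong : ∀ m {f g} → Agree m f g → InHᶠ m f → InHᶠ m g
InHᶠ-cong zero    _  _ = tt
InHᶠ-cong (suc m) fg (f[2^m] , fold-f) =
  trans (sym (fg (2 ^ m) (2^>0 m) (2^<2^suc m))) f[2^m] , InHᶠ-cong m (fold-cong m fg) fold-f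

InHᶠ-empty : ∀ m → InHᶠ m (λ _ → false)
InHᶠ-empty zero    = tt
InHᶠ-empty (suc m) = refl , InHᶠ-empty m

InHᶠ-xor : ∀ m {f g} → InHᶠ m f → InHᶠ m g → InHᶠ m (λ x → f x xor g x)
InHᶠ-xor zero    _ _ = tt
InHᶠ-xor (suc m) {f} {g} (f[2^m] , fold-f) (g[2^m] , fold-g) =
  cong₂ _xor_ f[2^m] g[2^m] ,
  InHᶠ-cong m (λ x _ _ → sym (fold-xor m f g x)) (InHᶠ-xor m fold-f fold-g)

pairᶠ : ℕ → ℕ → ℕ → Bool
pairᶠ a b x = (x ≡ᵇ a) ∨ (x ≡ᵇ b)

InHᶠ-pair : ∀ m k j → k < m → 0 < j → j < 2 ^ k → InHᶠ m (pairᶠ j (2 ^ k + j))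
InHᶠ-pair (suc m) k j k<1+m 0<j j<2^k with m≤n⇒m<n∨m≡n (s≤s⁻¹ k<1+m)
... | inj₁ k<m = pair-misses (2 ^ m) ≤-refl ,
                 InHᶠ-cong m (λ x _ _ → sym (fold-vanishing m _ pair-misses x))
                   (InHᶠ-pair m k j k<m 0<j j<2^k)
  where
    2^k+j<2^m : 2 ^ k + j < 2 ^ m
    2^k+j<2^m = <-≤-trans (+-<-2^suc k j<2^k) (^-monoʳ-≤ 2 k<m)
    pair-misses : ∀ y → 2 ^ m ≤ y → pairᶠ j (2 ^ k + j) y ≡ false
    pair-misses y 2^m≤y
      rewrite ≡ᵇ-false {y} {j} (>⇒≢ (<-≤-trans (≤-<-trans (m≤n+m j (2 ^ k)) 2^k+j<2^m) 2^m≤y))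
            | ≡ᵇ-false {y} {2 ^ k + j} (>⇒≢ (<-≤-trans 2^k+j<2^m 2^m≤y)) = refl
... | inj₂ refl = 2^k∉pair , InHᶠ-cong k (λ x _ x<2^k → sym (fold-pair x x<2^k)) (InHᶠ-empty k)
  where
    2^k∉pair : pairᶠ j (2 ^ k + j) (2 ^ k) ≡ false
    2^k∉pair rewrite ≡ᵇ-false {2 ^ k} {j} (>⇒≢ j<2^k)
                   | ≡ᵇ-false {2 ^ k} {2 ^ k + j} (<⇒≢ (m<m+n (2 ^ k) 0<j)) = refl
    fold-pair : ∀ x → x < 2 ^ k → fold k (pairᶠ j (2 ^ k + j)) x ≡ false
    fold-pair x x<2^k
      rewrite ≡ᵇ-false {x} {2 ^ k + j} (<⇒≢ (<-≤-trans x<2^k (m≤m+n (2 ^ k) j)))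
            | ≡ᵇ-false {2 ^ k + x} {j} (>⇒≢ (<-≤-trans j<2^k (m≤m+n (2 ^ k) x)))
            | ∨-identityʳ (x ≡ᵇ j)
            | +-cancelˡ-≡ᵇ (2 ^ k) x j = xor-same (x ≡ᵇ j)

InH⇒InHᶠ : ∀ m {B} → InH m B → InHᶠ m (χ B)
InH⇒InHᶠ m H-∅ = InHᶠ-cong m (λ x _ _ → sym (χ-∅ m x)) (InHᶠ-empty m)
InH⇒InHᶠ m (H-gen (suc k , j , _ , k<m , 0<j , j≤2^k∸1 , refl)) =
  InHᶠ-cong m (Agree-sym m (χ-setOf m _)) (InHᶠ-pair m k j k<m 0<j (≤∸1⇒< (2^>0 k) j≤2^k∸1))
InH⇒InHᶠ m (H-Δ {A} {B} hA hB) =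
  InHᶠ-cong m (λ x _ _ → sym (χ-Δ m A B x)) (InHᶠ-xor m (InH⇒InHᶠ m hA) (InH⇒InHᶠ m hB))

<ᵇ-suc-∧ : ∀ t y (c : ℕ → Bool) →
  ((y <ᵇ suc t) ∧ c y) ≡ ((y <ᵇ t) ∧ c y) xor (c t ∧ (y ≡ᵇ t))
<ᵇ-suc-∧ t y c with <-cmp y t
... | tri< y<t _ _
  rewrite <ᵇ-true (m<n⇒m<1+n y<t) | <ᵇ-true y<t | ≡ᵇ-false (<⇒≢ y<t)
        | ∧-zeroʳ (c t) = sym (xor-identityʳ (c y))
... | tri≈ _ refl _
  rewrite <ᵇ-true (n<1+n y) | <ᵇ-false (n≮n y) | ≡ᵇ-true (refl {x = y})
        | ∧-identityʳ (c y) = refl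
... | tri> _ _ y>t
  rewrite <ᵇ-false (≤⇒≯ y>t) | <ᵇ-false (<⇒≯ y>t) | ≡ᵇ-false (>⇒≢ y>t)
        | ∧-zeroʳ (c t) = refl

∸2^k<2^k : ∀ k → x < 2 ^ suc k → x ∸ 2 ^ k < 2 ^ k
∸2^k<2^k {x} k x<2^1+k = m<n+o⇒m∸n<o x (2 ^ k) {{>-nonZero (2^>0 k)}} (subst (x <_) (2^-suc k) x<2^1+k)

2^k≤∸2^k : ∀ k → 2 ^ suc k ≤ x → 2 ^ k ≤ x ∸ 2 ^ k
2^k≤∸2^k {x} k 2^1+k≤x =
  subst (_≤ x ∸ 2 ^ k) (m+n∸m≡n (2 ^ k) (2 ^ k))
    (∸-monoˡ-≤ (2 ^ k) (subst (_≤ x) (2^-suc k) 2^1+k≤x))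

offset : ℕ → ℕ → ℕ
offset k x = if x <ᵇ 2 ^ k then x else x ∸ 2 ^ k

offset-≡ᵇ : ∀ k t x → t < 2 ^ k → (offset k x ≡ᵇ t) ≡ pairᶠ t (2 ^ k + t) x
offset-≡ᵇ k t x t<2^k with x <? 2 ^ k
... | yes x<2^k
  rewrite <ᵇ-true x<2^k | ≡ᵇ-false {x} {2 ^ k + t} (<⇒≢ (<-≤-trans x<2^k (m≤m+n (2 ^ k) t)))
  = sym (∨-identityʳ (x ≡ᵇ t))
... | no x≮2^k
  rewrite <ᵇ-false x≮2^k | ≡ᵇ-false {x} {t} (>⇒≢ (<-≤-trans t<2^k (≮⇒≥ x≮2^k)))
  = trans (sym (+-cancelˡ-≡ᵇ (2 ^ k) (x ∸ 2 ^ k) t))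
          (cong (_≡ᵇ 2 ^ k + t) (m+[n∸m]≡n (≮⇒≥ x≮2^k)))

-- the union of the pairs {s, 2^k + s} over those s < t with c s
pairSum : ℕ → (ℕ → Bool) → ℕ → ℕ → Bool
pairSum k c t x = (offset k x <ᵇ t) ∧ c (offset k x)

pairSum-suc : ∀ k c t x → t < 2 ^ k →
  pairSum k c (suc t) x ≡ pairSum k c t x xor (c t ∧ pairᶠ t (2 ^ k + t) x)
pairSum-suc k c t x t<2^k =
  trans (<ᵇ-suc-∧ t (offset k x) c)
        (cong (λ e → pairSum k c t x xor (c t ∧ e)) (offset-≡ᵇ k t x t<2^k))

InH-pairᶠ-if : ∀ m k (c : ℕ → Bool) t → k < m → c 0 ≡ false → t < 2 ^ k →
  InH m (setOf m (λ x → c t ∧ pairᶠ t (2 ^ k + t) x))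
InH-pairᶠ-if m k c t k<m c0 t<2^k with c t in ct
... | false = subst (InH m) (sym (setOf-false m)) H-∅
... | true with t | k
...   | zero   | _      = ⊥-elim (true≢false (trans (sym ct) c0))
...   | suc _  | zero   = ⊥-elim (<⇒≱ t<2^k (s≤s z≤n))
...   | suc t′ | suc k′ =
  H-gen (suc (suc k′) , suc t′ , s≤s (s≤s z≤n) , k<m , s≤s z≤n , <⇒≤∸1 t<2^k , refl)

InH-pairSum : ∀ m k (c : ℕ → Bool) → k < m → c 0 ≡ false → ∀ t → t ≤ 2 ^ k →
  InH m (setOf m (pairSum k c t))
InH-pairSum m k c k<m c0 zero _ = subst (InH m) (sym (setOf-false m)) H-∅
InH-pairSum m k c k<m c0 (suc t) t<2^k =
  subst (InH m) (trans (sym (setOf-xor m (pairSum k c t) (λ x → c t ∧ pairᶠ t (2 ^ k + t) x)))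
                   (setOf-cong m λ x _ _ → sym (pairSum-suc k c t x t<2^k)))
    (H-Δ (InH-pairSum m k c k<m c0 t (<⇒≤ t<2^k)) (InH-pairᶠ-if m k c t k<m c0 t<2^k))

split-at-2^k : ∀ k f x → (2 ^ suc k ≤ x → f x ≡ false) →
  ((x <ᵇ 2 ^ k) ∧ fold k f x) xor pairSum k (λ y → f (2 ^ k + y)) (2 ^ k) x ≡ f x
split-at-2^k k f x f-beyond with x <? 2 ^ k
-- the second rewrite is of offset k x <ᵇ 2 ^ k, once offset k x has reduced to x
... | yes x<2^k rewrite <ᵇ-true x<2^k | <ᵇ-true x<2^k = xor-cancelʳ (f x) (f (2 ^ k + x))
... | no x≮2^k with x <? 2 ^ suc k
...   | yes x<2^1+k rewrite <ᵇ-false x≮2^k | <ᵇ-true (∸2^k<2^k k x<2^1+k)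
  = cong f (m+[n∸m]≡n (≮⇒≥ x≮2^k))
...   | no x≮2^1+k rewrite <ᵇ-false x≮2^k | <ᵇ-false (≤⇒≯ (2^k≤∸2^k k (≮⇒≥ x≮2^1+k)))
  = sym (f-beyond (≮⇒≥ x≮2^1+k))

-- f is the sum of its fold (placed in [1, 2^k)) and of the pairs {y, 2^k + y} with 2^k + y ∈ f.
InHᶠ⇒InH-≤ : ∀ m k f → k ≤ m → InHᶠ k f → (∀ x → 2 ^ k ≤ x → x < 2 ^ m → f x ≡ false) →
  InH m (setOf m f)
InHᶠ⇒InH-≤ m zero f _ _ f-beyond =
  subst (InH m) (sym (trans (setOf-cong m f-beyond) (setOf-false m))) H-∅
InHᶠ⇒InH-≤ m (suc k) f k<m (f[2^k] , fold-f) f-beyond =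
  subst (InH m) (trans (sym (setOf-xor m lower upper))
                       (setOf-cong m λ x _ x<2^m → split-at-2^k k f x (λ le → f-beyond x le x<2^m)))
    (H-Δ (InHᶠ⇒InH-≤ m k lower (<⇒≤ k<m) (InHᶠ-cong k lower-agrees fold-f) lower-beyond)
         (InH-pairSum m k (λ y → f (2 ^ k + y)) k<m
            (trans (cong f (+-identityʳ (2 ^ k))) f[2^k]) (2 ^ k) ≤-refl))
  where
    lower upper : ℕ → Bool
    lower x = (x <ᵇ 2 ^ k) ∧ fold k f x
    upper = pairSum k (λ y → f (2 ^ k + y)) (2 ^ k)
    lower-agrees : Agree k (fold k f) lower
    lower-agrees x _ x<2^k rewrite <ᵇ-true x<2^k = refl
    lower-beyond : ∀ x → 2 ^ k ≤ x → x < 2 ^ m → lower x ≡ false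
    lower-beyond x 2^k≤x _ rewrite <ᵇ-false (≤⇒≯ 2^k≤x) = refl

InHᶠ⇒InH : ∀ m {B} → InHᶠ m (χ B) → InH m B
InHᶠ⇒InH m {B} h = subst (InH m) (setOf-χ m B)
  (InHᶠ⇒InH-≤ m m (χ B) ≤-refl h (λ x 2^m≤x x<2^m → ⊥-elim (<⇒≱ x<2^m 2^m≤x)))

between : ℕ → ℕ → ℕ → Bool
between a b y = (a ≤ᵇ y) ∧ (y ≤ᵇ b)

between-outside : (a ≤ x → x ≤ b → ⊥) → between a b x ≡ false
between-outside {a} {x} {b} ∉[a,b] with a ≤? x | x ≤? b
... | yes a≤x | yes x≤b = ⊥-elim (∉[a,b] a≤x x≤b)
... | yes _   | no x≰b  = trans (cong ((a ≤ᵇ x) ∧_) (≤ᵇ-false x≰b)) (∧-zeroʳ _)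
... | no a≰x  | _       = cong (_∧ (x ≤ᵇ b)) (≤ᵇ-false a≰x)

+-cancelˡ-≤ᵇ : ∀ n a b → (n + a ≤ᵇ n + b) ≡ (a ≤ᵇ b)
+-cancelˡ-≤ᵇ n a b with a ≤? b
... | yes a≤b = trans (≤ᵇ-true (+-monoʳ-≤ n a≤b)) (sym (≤ᵇ-true a≤b))
... | no a≰b  = trans (≤ᵇ-false (a≰b ∘ +-cancelˡ-≤ n a b)) (sym (≤ᵇ-false a≰b))

fold-between-below : ∀ k a b y → b < 2 ^ k → fold k (between a b) y ≡ between a b y
fold-between-below k a b y b<2^k =
  fold-vanishing k (between a b)
    (λ z 2^k≤z → between-outside {a = a} {b = b} (λ _ z≤b → <⇒≱ b<2^k (≤-trans 2^k≤z z≤b))) y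

fold-between-above : ∀ k a b y → 2 ^ k < a → a ≤ b → y < 2 ^ k →
  fold k (between a b) y ≡ between (a ∸ 2 ^ k) (b ∸ 2 ^ k) y
fold-between-above k a b y 2^k<a a≤b y<2^k =
  trans (cong (_xor between a b (2 ^ k + y))
              (between-outside (λ a≤y _ → <⇒≱ (<-trans y<2^k 2^k<a) a≤y)))
        (cong₂ _∧_ (shift-≤ᵇ (2 ^ k) a y (<⇒≤ 2^k<a))
                   (trans (cong (2 ^ k + y ≤ᵇ_) (sym (m+[n∸m]≡n 2^k≤b)))
                          (+-cancelˡ-≤ᵇ (2 ^ k) y (b ∸ 2 ^ k))))
  where
    2^k≤b : 2 ^ k ≤ b
    2^k≤b = ≤-trans (<⇒≤ 2^k<a) a≤b
    shift-≤ᵇ : ∀ n a y → n ≤ a → (a ≤ᵇ n + y) ≡ (a ∸ n ≤ᵇ y)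
    shift-≤ᵇ n a y n≤a =
      trans (cong (_≤ᵇ n + y) (sym (m+[n∸m]≡n n≤a))) (+-cancelˡ-≤ᵇ n (a ∸ n) y)

between∉InHᶠ : ∀ m f a b x → Agree m f (between a b) →
  0 < x → x < 2 ^ m → a ≤ x → x ≤ b → ¬ InHᶠ m f
between∉InHᶠ zero    f a b x _ 0<x x<1 _ _ _ = <⇒≱ x<1 0<x
between∉InHᶠ (suc k) f a b x f≐ 0<x x<2^1+k a≤x x≤b (f[2^k] , fold-f) with a ≤? 2 ^ k | 2 ^ k ≤? b
... | yes a≤2^k | yes 2^k≤b =
  true≢false (trans (sym (trans (f≐ (2 ^ k) (2^>0 k) (2^<2^suc k))
                               (cong₂ _∧_ (≤ᵇ-true a≤2^k) (≤ᵇ-true 2^k≤b))))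
                    f[2^k])
... | yes _ | no 2^k≰b =
  between∉InHᶠ k (fold k f) a b x
    (Agree-trans k (fold-cong k f≐) (λ y _ _ → fold-between-below k a b y (≰⇒> 2^k≰b)))
    0<x (≤-<-trans x≤b (≰⇒> 2^k≰b)) a≤x x≤b fold-f
... | no a≰2^k | _ =
  between∉InHᶠ k (fold k f) (a ∸ 2 ^ k) (b ∸ 2 ^ k) (x ∸ 2 ^ k)
    (Agree-trans k (fold-cong k f≐)
      (λ y _ y<2^k → fold-between-above k a b y (≰⇒> a≰2^k) (≤-trans a≤x x≤b) y<2^k))
    (m<n⇒0<n∸m (<-≤-trans (≰⇒> a≰2^k) a≤x)) (∸2^k<2^k k x<2^1+k)
    (∸-monoˡ-≤ (2 ^ k) a≤x) (∸-monoˡ-≤ (2 ^ k) x≤b) fold-f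

interval-empty : ∀ m a b → (∀ x → 0 < x → x < 2 ^ m → a ≤ x → x ≤ b → ⊥) →
  interval m a b ≡ ∅ m
interval-empty m a b none =
  trans (setOf-cong m (λ x 0<x x<2^m → between-outside (none x 0<x x<2^m))) (setOf-false m)

nonempty-interval∉H : ∀ m (B : Ground m) → InH m B → ¬ (B ≡ ∅ m) →
  ¬ (Σ ℕ λ a → Σ ℕ λ b → B ≡ interval m a b)
nonempty-interval∉H m B B∈H B≢∅ (a , b , refl) with a ⊔ 1 ≤? b | a ⊔ 1 <? 2 ^ m
... | yes a⊔1≤b | yes a⊔1<2^m =
  between∉InHᶠ m _ a b (a ⊔ 1) (χ-setOf m (between a b))
    (m≤n⊔m a 1) a⊔1<2^m (m≤m⊔n a 1) a⊔1≤b (InH⇒InHᶠ m B∈H)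
... | no a⊔1≰b | _ =
  B≢∅ (interval-empty m a b (λ x 0<x _ a≤x x≤b → a⊔1≰b (≤-trans (⊔-lub a≤x 0<x) x≤b)))
... | yes _ | no a⊔1≮2^m =
  B≢∅ (interval-empty m a b (λ x 0<x x<2^m a≤x _ → a⊔1≮2^m (≤-<-trans (⊔-lub a≤x 0<x) x<2^m)))

length-cartesianProductWith : ∀ {A B C : Set} (f : A → B → C) xs ys →
  length (cartesianProductWith f xs ys) ≡ length xs * length ys
length-cartesianProductWith f []       ys = refl
length-cartesianProductWith f (x ∷ xs) ys =
  trans (length-++ (map (f x) ys)) (cong₂ _+_ (length-map (f x) ys) (length-cartesianProductWith f xs ys))

allVecs : ∀ n → List (Vec Bool n)
allVecs zero    = [] ∷ []
allVecs (suc n) = cartesianProductWith _∷_ (true ∷ false ∷ []) (allVecs n)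

allVecs-unique : ∀ n → Unique (allVecs n)
allVecs-unique zero    = [] ∷ []
allVecs-unique (suc n) =
  cartesianProductWith⁺ _∷_ ∷-injective (((λ ()) ∷ []) ∷ [] ∷ []) (allVecs-unique n)

∈-allVecs : ∀ n (v : Vec Bool n) → v ∈ allVecs n
∈-allVecs zero    []          = here refl
∈-allVecs (suc n) (true ∷ v)  = ∈-cartesianProductWith⁺ _∷_ {xs = true ∷ false ∷ []} (here refl) (∈-allVecs n v)
∈-allVecs (suc n) (false ∷ v) =
  ∈-cartesianProductWith⁺ _∷_ {xs = true ∷ false ∷ []} (there (here refl)) (∈-allVecs n v)

length-allVecs : ∀ n → length (allVecs n) ≡ 2 ^ n
length-allVecs zero    = refl
length-allVecs (suc n) =
  trans (length-cartesianProductWith _∷_ (true ∷ false ∷ []) (allVecs n)) (cong (2 *_) (length-allVecs n))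

-- the set at level m + 1 with upper half a (shifted down by 2^m) and fold h
unfoldᶠ : ∀ m → Ground m → Ground m → ℕ → Bool
unfoldᶠ m a h x = if x <ᵇ 2 ^ m then χ h x xor χ a x else χ a (x ∸ 2 ^ m)

unfold : ∀ m → Ground m → Ground m → Ground (suc m)
unfold m a h = setOf (suc m) (unfoldᶠ m a h)

unfoldᶠ-low : ∀ m a h x → x < 2 ^ m → unfoldᶠ m a h x ≡ χ h x xor χ a x
unfoldᶠ-low m a h x x<2^m rewrite <ᵇ-true x<2^m = refl

unfoldᶠ-high : ∀ m a h x → unfoldᶠ m a h (2 ^ m + x) ≡ χ a x
unfoldᶠ-high m a h x rewrite <ᵇ-false (≤⇒≯ (m≤m+n (2 ^ m) x)) | m+n∸m≡n (2 ^ m) x = refl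

χ-unfold-low : ∀ m a h x → 0 < x → x < 2 ^ m → χ (unfold m a h) x ≡ χ h x xor χ a x
χ-unfold-low m a h x 0<x x<2^m =
  trans (χ-setOf (suc m) (unfoldᶠ m a h) x 0<x (<-trans x<2^m (2^<2^suc m))) (unfoldᶠ-low m a h x x<2^m)

χ-unfold-high : ∀ m a h x → x < 2 ^ m → χ (unfold m a h) (2 ^ m + x) ≡ χ a x
χ-unfold-high m a h x x<2^m =
  trans (χ-setOf (suc m) (unfoldᶠ m a h) (2 ^ m + x)
          (<-≤-trans (2^>0 m) (m≤m+n (2 ^ m) x)) (+-<-2^suc m x<2^m))
        (unfoldᶠ-high m a h x)

InHᶠ-unfold : ∀ m a h → InHᶠ m (χ h) → InHᶠ (suc m) (χ (unfold m a h))
InHᶠ-unfold m a h h∈H =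
  trans (cong (χ (unfold m a h)) (sym (+-identityʳ (2 ^ m))))
        (trans (χ-unfold-high m a h 0 (2^>0 m)) (χ-zero a)) ,
  InHᶠ-cong m fold≐h h∈H
  where
    fold≐h : Agree m (χ h) (fold m (χ (unfold m a h)))
    fold≐h x 0<x x<2^m =
      sym (trans (cong₂ _xor_ (χ-unfold-low m a h x 0<x x<2^m) (χ-unfold-high m a h x x<2^m))
                 (xor-cancelʳ (χ h x) (χ a x)))

unfold-injective : ∀ m {a a′ h h′} → unfold m a h ≡ unfold m a′ h′ → a ≡ a′ × h ≡ h′
unfold-injective m {a} {a′} {h} {h′} eq = χ-injective m a a′ a≐a′ , χ-injective m h h′ h≐h′
  where
    a≐a′ : Agree m (χ a) (χ a′)
    a≐a′ x _ x<2^m = trans (sym (χ-unfold-high m a h x x<2^m))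
                       (trans (cong (λ B → χ B (2 ^ m + x)) eq) (χ-unfold-high m a′ h′ x x<2^m))
    h≐h′ : Agree m (χ h) (χ h′)
    h≐h′ x 0<x x<2^m = begin
      χ h x                     ≡⟨ sym (xor-cancelʳ (χ h x) (χ a x)) ⟩
      (χ h x xor χ a x) xor χ a x ≡⟨ cong₂ _xor_ (trans (sym (χ-unfold-low m a h x 0<x x<2^m))
                                      (trans (cong (λ B → χ B x) eq) (χ-unfold-low m a′ h′ x 0<x x<2^m)))
                                    (a≐a′ x 0<x x<2^m) ⟩
      (χ h′ x xor χ a′ x) xor χ a′ x ≡⟨ xor-cancelʳ (χ h′ x) (χ a′ x) ⟩
      χ h′ x                    ∎
      where open ≡-Reasoning

upperHalf : ∀ m → Ground (suc m) → Ground m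
upperHalf m B = setOf m (λ x → χ B (2 ^ m + x))

foldSet : ∀ m → Ground (suc m) → Ground m
foldSet m B = setOf m (fold m (χ B))

unfold-halves : ∀ m (B : Ground (suc m)) → χ B (2 ^ m) ≡ false →
  B ≡ unfold m (upperHalf m B) (foldSet m B)
unfold-halves m B B[2^m] =
  χ-injective (suc m) B _ λ x 0<x x<2^1+m →
    sym (trans (χ-setOf (suc m) (unfoldᶠ m upper folded) x 0<x x<2^1+m) (at x 0<x x<2^1+m))
  where
    upper = upperHalf m B
    folded = foldSet m B
    χ-upperHalf : ∀ y → y < 2 ^ m → χ upper y ≡ χ B (2 ^ m + y)
    χ-upperHalf zero    _     = trans (χ-zero upper) (sym (trans (cong (χ B) (+-identityʳ (2 ^ m))) B[2^m]))
    χ-upperHalf (suc y) y<2^m = χ-setOf m (λ x → χ B (2 ^ m + x)) (suc y) (s≤s z≤n) y<2^m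
    at : ∀ x → 0 < x → x < 2 ^ suc m → unfoldᶠ m upper folded x ≡ χ B x
    at x 0<x x<2^1+m with x <? 2 ^ m
    ... | yes x<2^m = trans (unfoldᶠ-low m upper folded x x<2^m)
        (trans (cong₂ _xor_ (χ-setOf m (fold m (χ B)) x 0<x x<2^m) (χ-upperHalf x x<2^m))
               (xor-cancelʳ (χ B x) (χ B (2 ^ m + x))))
    ... | no x≮2^m = begin
      unfoldᶠ m upper folded x
        ≡⟨ cong (unfoldᶠ m upper folded) (sym (m+[n∸m]≡n 2^m≤x)) ⟩
      unfoldᶠ m upper folded (2 ^ m + (x ∸ 2 ^ m))
        ≡⟨ unfoldᶠ-high m upper folded (x ∸ 2 ^ m) ⟩
      χ upper (x ∸ 2 ^ m)
        ≡⟨ χ-upperHalf (x ∸ 2 ^ m) (∸2^k<2^k m x<2^1+m) ⟩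
      χ B (2 ^ m + (x ∸ 2 ^ m))
        ≡⟨ cong (χ B) (m+[n∸m]≡n 2^m≤x) ⟩
      χ B x ∎
      where
        open ≡-Reasoning
        2^m≤x : 2 ^ m ≤ x
        2^m≤x = ≮⇒≥ x≮2^m

H-list : ∀ m → List (Ground m)
H-list zero    = [] ∷ []
H-list (suc m) = cartesianProductWith (unfold m) (allVecs (2 ^ m ∸ 1)) (H-list m)

H-list-unique : ∀ m → Unique (H-list m)
H-list-unique zero    = [] ∷ []
H-list-unique (suc m) =
  cartesianProductWith⁺ (unfold m) (unfold-injective m) (allVecs-unique (2 ^ m ∸ 1)) (H-list-unique m)

∈-H-list⇒InHᶠ : ∀ m B → B ∈ H-list m → InHᶠ m (χ B)
∈-H-list⇒InHᶠ zero    B _ = tt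
∈-H-list⇒InHᶠ (suc m) B B∈ with ∈-cartesianProductWith⁻ (unfold m) (allVecs (2 ^ m ∸ 1)) (H-list m) B∈
... | a , h , _ , h∈ , refl = InHᶠ-unfold m a h (∈-H-list⇒InHᶠ m h h∈)

InHᶠ⇒∈-H-list : ∀ m B → InHᶠ m (χ B) → B ∈ H-list m
InHᶠ⇒∈-H-list zero    [] _ = here refl
InHᶠ⇒∈-H-list (suc m) B (B[2^m] , fold-B) =
  subst (_∈ H-list (suc m)) (sym (unfold-halves m B B[2^m]))
    (∈-cartesianProductWith⁺ (unfold m) (∈-allVecs _ (upperHalf m B))
      (InHᶠ⇒∈-H-list m (foldSet m B) (InHᶠ-cong m (Agree-sym m (χ-setOf m (fold m (χ B)))) fold-B)))

n<2^n : ∀ n → n < 2 ^ n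
n<2^n zero    = s≤s z≤n
n<2^n (suc n) = subst (suc n <_) (sym (2^-suc n)) (+-mono-≤-< (2^>0 n) (n<2^n n))

exponent-step : ∀ m Q → m < Q → (Q ∸ 1) + (Q ∸ m ∸ 1) ≡ (Q + Q) ∸ suc m ∸ 1
exponent-step m Q m<Q = begin
  (Q ∸ 1) + (Q ∸ m ∸ 1)   ≡⟨ cong ((Q ∸ 1) +_) (∸-+-assoc Q m 1) ⟩
  (Q ∸ 1) + (Q ∸ (m + 1)) ≡⟨ sym (+-∸-assoc (Q ∸ 1) (subst (_≤ Q) (+-comm 1 m) m<Q)) ⟩
  (Q ∸ 1 + Q) ∸ (m + 1)   ≡⟨ cong (_∸ (m + 1)) (sym (+-∸-comm Q (≤-trans (s≤s z≤n) m<Q))) ⟩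
  (Q + Q ∸ 1) ∸ (m + 1)   ≡⟨ ∸-+-assoc (Q + Q) 1 (m + 1) ⟩
  (Q + Q) ∸ (suc m + 1)   ≡⟨ sym (∸-+-assoc (Q + Q) (suc m) 1) ⟩
  (Q + Q) ∸ suc m ∸ 1     ∎
  where open ≡-Reasoning

length-H-list : ∀ m → length (H-list m) ≡ 2 ^ (2 ^ m ∸ m ∸ 1)
length-H-list zero    = refl
length-H-list (suc m) = begin
  length (H-list (suc m))
    ≡⟨ length-cartesianProductWith (unfold m) (allVecs _) (H-list m) ⟩
  length (allVecs (2 ^ m ∸ 1)) * length (H-list m)
    ≡⟨ cong₂ _*_ (length-allVecs (2 ^ m ∸ 1)) (length-H-list m) ⟩
  2 ^ (2 ^ m ∸ 1) * 2 ^ (2 ^ m ∸ m ∸ 1)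
    ≡⟨ sym (^-distribˡ-+-* 2 (2 ^ m ∸ 1) (2 ^ m ∸ m ∸ 1)) ⟩
  2 ^ ((2 ^ m ∸ 1) + (2 ^ m ∸ m ∸ 1))
    ≡⟨ cong (2 ^_) (exponent-step m (2 ^ m) (n<2^n m)) ⟩
  2 ^ ((2 ^ m + 2 ^ m) ∸ suc m ∸ 1)
    ≡⟨ cong (λ e → 2 ^ (e ∸ suc m ∸ 1)) (sym (2^-suc m)) ⟩
  2 ^ (2 ^ suc m ∸ suc m ∸ 1) ∎
  where open ≡-Reasoning

H-card : ∀ m → HasCard m (InH m) (2 ^ (nOf m ∸ m ∸ 1))
H-card m = H-list m , H-list-unique m ,
  (λ B → InHᶠ⇒InH m ∘ ∈-H-list⇒InHᶠ m B , InHᶠ⇒∈-H-list m B ∘ InH⇒InHᶠ m) ,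
  length-H-list m

InCosetᶠ : ∀ m → (ℕ → Bool) → Ground m → Set
InCosetᶠ m f B = InHᶠ m (λ x → f x xor χ B x)

Coset⇒InCosetᶠ : ∀ m c {B} → Coset m c B → InCosetᶠ m (χ c) B
Coset⇒InCosetᶠ m c (h , h∈H , refl) =
  InHᶠ-cong m (λ x _ _ → sym (trans (cong (χ c x xor_) (χ-Δ m c h x)) (xor-cancelˡ (χ c x) (χ h x))))
    (InH⇒InHᶠ m h∈H)

InCosetᶠ⇒Coset : ∀ m c {B} → InCosetᶠ m (χ c) B → Coset m c B
InCosetᶠ⇒Coset m c {B} B∈cH =
  _Δ_ m c B , InHᶠ⇒InH m (InHᶠ-cong m (λ x _ _ → sym (χ-Δ m c B x)) B∈cH) ,
  χ-injective m B (_Δ_ m c (_Δ_ m c B)) λ x _ _ →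
    sym (trans (χ-Δ m c (_Δ_ m c B) x)
               (trans (cong (χ c x xor_) (χ-Δ m c B x)) (xor-cancelˡ (χ c x) (χ B x))))

InCosetᶠ-cong : ∀ m {f g} B → Agree m f g → InCosetᶠ m f B → InCosetᶠ m g B
InCosetᶠ-cong m B f≐g = InHᶠ-cong m (λ x 0<x x<2^m → cong (_xor χ B x) (f≐g x 0<x x<2^m))

InCosetᶠ-move : ∀ m f g B → InHᶠ m (λ x → f x xor g x) → InCosetᶠ m f B → InCosetᶠ m g B
InCosetᶠ-move m f g B f+g∈H B∈fH =
  InHᶠ-cong m (λ x _ _ → xor-cancel-middle (f x) (g x) (χ B x)) (InHᶠ-xor m f+g∈H B∈fH)

prefix : ℕ → ℕ → Bool
prefix k = between 1 (2 * k)

prefix-zero : ∀ m → Agree m (prefix 0) (λ _ → false)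
prefix-zero m (suc _) _ _ = refl

Hi⇒InCosetᶠ : ∀ m k B → Hi m (suc k) B → InCosetᶠ m (prefix k) B
Hi⇒InCosetᶠ m zero    B B∈H  = InCosetᶠ-cong m B (Agree-sym m (prefix-zero m)) (InH⇒InHᶠ m B∈H)
Hi⇒InCosetᶠ m (suc k) B B∈cH =
  InCosetᶠ-cong m B (χ-setOf m (prefix (suc k))) (Coset⇒InCosetᶠ m _ B∈cH)

InCosetᶠ⇒Hi : ∀ m k B → InCosetᶠ m (prefix k) B → Hi m (suc k) B
InCosetᶠ⇒Hi m zero    B B∈cH = InHᶠ⇒InH m (InCosetᶠ-cong m B (prefix-zero m) B∈cH)
InCosetᶠ⇒Hi m (suc k) B B∈cH =
  InCosetᶠ⇒Coset m _ (InCosetᶠ-cong m B (Agree-sym m (χ-setOf m (prefix (suc k)))) B∈cH)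

prefix-xor : ∀ m a b → a ≤ b →
  Agree m (λ x → prefix b x xor prefix a x) (between (suc (2 * a)) (2 * b))
prefix-xor m a b a≤b (suc y) _ _ with suc y ≤? 2 * a | suc y ≤? 2 * b
... | yes y<2a | _
  rewrite ≤ᵇ-true y<2a | ≤ᵇ-true (≤-trans y<2a (*-monoʳ-≤ 2 a≤b)) | ≤ᵇ-false (<⇒≱ (s≤s y<2a))
  = refl
... | no y≮2a | yes y<2b rewrite ≤ᵇ-false y≮2a | ≤ᵇ-true y<2b | ≤ᵇ-true (≰⇒> y≮2a) = refl
... | no y≮2a | no y≮2b
  rewrite ≤ᵇ-false y≮2a | ≤ᵇ-false y≮2b | ∧-zeroʳ (suc (2 * a) ≤ᵇ suc y) = refl

prefix-in-own-coset : ∀ m k → InCosetᶠ m (prefix k) (setOf m (prefix k))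
prefix-in-own-coset m k =
  InHᶠ-cong m (λ x 0<x x<2^m → sym (trans (cong (prefix k x xor_) (χ-setOf m (prefix k) x 0<x x<2^m))
                                          (xor-same (prefix k x))))
    (InHᶠ-empty m)

prefix-cosets-distinct : ∀ m i j → i < j → 2 * j < 2 ^ m → ¬ SameSet m (Hi m (suc i)) (Hi m (suc j))
prefix-cosets-distinct m i j i<j 2j<2^m same =
  between∉InHᶠ m _ (suc (2 * i)) (2 * j) (2 * j)
    (Agree-trans m (λ x 0<x x<2^m → cong (prefix j x xor_) (χ-setOf m (prefix i) x 0<x x<2^m))
                   (prefix-xor m i j (<⇒≤ i<j)))
    (*-monoʳ-< 2 (≤-<-trans z≤n i<j)) 2j<2^m (*-monoʳ-< 2 i<j) ≤-refl
    (Hi⇒InCosetᶠ m j P (proj₁ (same P) (InCosetᶠ⇒Hi m i P (prefix-in-own-coset m i))))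
  where P = setOf m (prefix i)

-- the parity of f on [1, 2^m)
parity : ℕ → (ℕ → Bool) → Bool
parity zero    f = false
parity (suc m) f = f (2 ^ m) xor parity m (fold m f)

parity-false : ∀ m → parity m (λ _ → false) ≡ false
parity-false zero    = refl
parity-false (suc m) = parity-false m

parity-cong : ∀ m {f g} → Agree m f g → parity m f ≡ parity m g
parity-cong zero    _   = refl
parity-cong (suc m) f≐g =
  cong₂ _xor_ (f≐g (2 ^ m) (2^>0 m) (2^<2^suc m)) (parity-cong m (fold-cong m f≐g))

parity-xor : ∀ m f g → parity m (λ x → f x xor g x) ≡ parity m f xor parity m g
parity-xor zero    f g = refl
parity-xor (suc m) f g =
  trans (cong ((f (2 ^ m) xor g (2 ^ m)) xor_)
              (trans (parity-cong m (λ x _ _ → fold-xor m f g x)) (parity-xor m (fold m f) (fold m g))))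
        (xor-interchange (f (2 ^ m)) (g (2 ^ m)) _ _)

parity-complement : ∀ m g → parity (suc m) (λ x → g x xor true) ≡ not (parity (suc m) g)
parity-complement m g = trans (parity-xor (suc m) g (λ _ → true))
  (trans (cong (parity (suc m) g xor_) (cong not (parity-false m))) (xor-comm (parity (suc m) g) true))

-- the parity of f on [a + 1, a + t]
rangeParity : ℕ → ℕ → (ℕ → Bool) → Bool
rangeParity zero    a f = false
rangeParity (suc t) a f = f (suc a) xor rangeParity t (suc a) f

rangeParity-+ : ∀ s t a f → rangeParity (s + t) a f ≡ rangeParity s a f xor rangeParity t (s + a) f
rangeParity-+ zero    t a f = refl
rangeParity-+ (suc s) t a f =
  trans (cong (f (suc a) xor_)
              (trans (rangeParity-+ s t (suc a) f)
                     (cong (λ b → rangeParity s (suc a) f xor rangeParity t b f) (+-suc s a))))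
        (sym (xor-assoc (f (suc a)) (rangeParity s (suc a) f) (rangeParity t (suc s + a) f)))

rangeParity-shift : ∀ t c a f → rangeParity t (c + a) f ≡ rangeParity t a (λ x → f (c + x))
rangeParity-shift zero    c a f = refl
rangeParity-shift (suc t) c a f =
  trans (cong (λ b → f b xor rangeParity t b f) (sym (+-suc c a)))
        (cong (f (c + suc a) xor_) (rangeParity-shift t c (suc a) f))

rangeParity-xor : ∀ t a f g →
  rangeParity t a (λ x → f x xor g x) ≡ rangeParity t a f xor rangeParity t a g
rangeParity-xor zero    a f g = refl
rangeParity-xor (suc t) a f g =
  trans (cong ((f (suc a) xor g (suc a)) xor_) (rangeParity-xor t (suc a) f g))
        (xor-interchange (f (suc a)) (g (suc a)) _ _)

parity≡rangeParity : ∀ m f → parity m f ≡ rangeParity (2 ^ m ∸ 1) 0 f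
parity≡rangeParity zero    f = refl
parity≡rangeParity (suc m) f = begin
  f P xor parity m (fold m f)
    ≡⟨ cong (f P xor_) (trans (parity≡rangeParity m (fold m f)) (rangeParity-xor P∸1 0 f _)) ⟩
  f P xor (rangeParity P∸1 0 f xor rangeParity P∸1 0 (λ x → f (P + x)))
    ≡⟨ xor-left-comm (f P) (rangeParity P∸1 0 f) _ ⟩
  rangeParity P∸1 0 f xor (f P xor rangeParity P∸1 0 (λ x → f (P + x)))
    ≡⟨ cong (λ r → rangeParity P∸1 0 f xor (f P xor r)) (sym (rangeParity-shift P∸1 P 0 f)) ⟩
  rangeParity P∸1 0 f xor (f P xor rangeParity P∸1 (P + 0) f)
    ≡⟨ cong₂ (λ a b → rangeParity P∸1 0 f xor (f a xor rangeParity P∸1 b f))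
             (sym (trans (cong suc (+-identityʳ P∸1)) 1+P∸1≡P)) (sym 1+P∸1≡P+0) ⟩
  rangeParity P∸1 0 f xor rangeParity (suc P∸1) (P∸1 + 0) f
    ≡⟨ sym (rangeParity-+ P∸1 (suc P∸1) 0 f) ⟩
  rangeParity (P∸1 + suc P∸1) 0 f
    ≡⟨ cong (λ t → rangeParity t 0 f) P∸1+P≡2P∸1 ⟩
  rangeParity (2 ^ suc m ∸ 1) 0 f ∎
  where
    open ≡-Reasoning
    P P∸1 : ℕ
    P = 2 ^ m
    P∸1 = P ∸ 1
    1+P∸1≡P : suc P∸1 ≡ P
    1+P∸1≡P = m+[n∸m]≡n (2^>0 m)
    1+P∸1≡P+0 : suc (P∸1 + 0) ≡ P + 0
    1+P∸1≡P+0 = trans (cong suc (+-identityʳ P∸1)) (trans 1+P∸1≡P (sym (+-identityʳ P)))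
    P∸1+P≡2P∸1 : P∸1 + suc P∸1 ≡ 2 ^ suc m ∸ 1
    P∸1+P≡2P∸1 = trans (cong (P∸1 +_) 1+P∸1≡P)
                       (trans (sym (+-∸-comm P (2^>0 m))) (cong (_∸ 1) (sym (2^-suc m))))

rangeParity-∷ : ∀ t a b (v : Vec Bool n) → rangeParity t (suc a) (χ (b ∷ v)) ≡ rangeParity t a (χ v)
rangeParity-∷ zero    a b v = refl
rangeParity-∷ (suc t) a b v = cong (χ v (suc a) xor_) (rangeParity-∷ t (suc a) b v)

∣∣≡rangeParity+even : (v : Vec Bool n) →
  Σ ℕ λ q → ∣ v ∣ ≡ (if rangeParity n 0 (χ v) then 1 else 0) + q * 2
∣∣≡rangeParity+even []                = 0 , refl
∣∣≡rangeParity+even {suc n} (b ∷ v) rewrite rangeParity-∷ n 0 b v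
  with b | rangeParity n 0 (χ v) | ∣∣≡rangeParity+even v
... | false | _     | q , e = q , e
... | true  | false | q , e = q , cong suc e
... | true  | true  | q , e = suc q , cong suc e

InG⇒parity-even : ∀ m (c : Ground m) → InG m c → parity m (χ c) ≡ false
InG⇒parity-even m c c-even = trans (parity≡rangeParity m (χ c)) (even⇒false c c-even)
  where
    even⇒false : (v : Vec Bool n) → ∣ v ∣ % 2 ≡ 0 → rangeParity n 0 (χ v) ≡ false
    even⇒false {n} v v-even with rangeParity n 0 (χ v) | ∣∣≡rangeParity+even v
    ... | false | _     = refl
    ... | true  | q , e =
      ⊥-elim (1+n≢0 (trans (sym ([m+kn]%n≡m%n 1 q 2)) (trans (cong (_% 2) (sym e)) v-even)))

prefix-beyond : ∀ k y → 2 * k < y → prefix k y ≡ false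
prefix-beyond k y 2k<y = between-outside {a = 1} {b = 2 * k} (λ _ y≤2k → <⇒≱ 2k<y y≤2k)

fold-prefix-above : ∀ m k x → 0 < x → x < 2 ^ suc m →
  fold (suc m) (prefix (2 ^ m + k)) x ≡ true xor prefix k x
fold-prefix-above m k (suc y) _ x<P = cong₂ _xor_ (≤ᵇ-true (≤-trans (<⇒≤ x<P) P≤2[2^m+k])) (begin
  (1 ≤ᵇ P + suc y) ∧ (P + suc y ≤ᵇ 2 * (2 ^ m + k))
    ≡⟨ cong₂ _∧_ (≤ᵇ-true (≤-trans (s≤s z≤n) (m≤n+m (suc y) P)))
                 (cong (P + suc y ≤ᵇ_) (*-distribˡ-+ 2 (2 ^ m) k)) ⟩
  true ∧ (P + suc y ≤ᵇ P + 2 * k)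
    ≡⟨ +-cancelˡ-≤ᵇ P (suc y) (2 * k) ⟩
  (suc y ≤ᵇ 2 * k) ∎)
  where
    open ≡-Reasoning
    P = 2 ^ suc m
    P≤2[2^m+k] : P ≤ 2 * (2 ^ m + k)
    P≤2[2^m+k] = *-monoʳ-≤ 2 (m≤m+n (2 ^ m) k)

fold-xor-prefix-below : ∀ m f k → k < 2 ^ m →
  Agree (suc m) (λ x → fold (suc m) f x xor prefix k x) (fold (suc m) (λ x → f x xor prefix k x))
fold-xor-prefix-below m f k k<2^m x _ _ = sym (trans (fold-xor (suc m) f (prefix k) x)
  (cong (fold (suc m) f x xor_)
        (fold-vanishing (suc m) (prefix k)
           (λ y P≤y → prefix-beyond k y (<-≤-trans (*-monoʳ-< 2 k<2^m) P≤y)) x)))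

fold-xor-prefix-above : ∀ m f k →
  Agree (suc m) (λ x → (fold (suc m) f x xor true) xor prefix k x)
                (fold (suc m) (λ x → f x xor prefix (2 ^ m + k) x))
fold-xor-prefix-above m f k x 0<x x<P = sym (trans (fold-xor (suc m) f (prefix (2 ^ m + k)) x)
  (trans (cong (fold (suc m) f x xor_) (fold-prefix-above m k x 0<x x<P))
         (sym (xor-assoc (fold (suc m) f x) true (prefix k x)))))

-- If f contains 2^(m+1), the prefix must reach past 2^(m+1); such a prefix folds to the complement
-- of a shorter one, hence the folded problem is posed for the complement of the fold of f.
even⇒prefix-coset : ∀ m f → parity (suc m) f ≡ false →
  Σ ℕ λ k → k < 2 ^ m × InHᶠ (suc m) (λ x → f x xor prefix k x)
even⇒prefix-coset zero    f f-even = 0 , s≤s z≤n , f-even , tt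
even⇒prefix-coset (suc m) f f-even = by-cases (f P) refl
  where
    P = 2 ^ suc m
    fold-parity : ∀ {b} → f P ≡ b → b xor parity (suc m) (fold (suc m) f) ≡ false
    fold-parity f[P] = trans (cong (_xor parity (suc m) (fold (suc m) f)) (sym f[P])) f-even
    by-cases : ∀ b → f P ≡ b → Σ ℕ λ k → k < P × InHᶠ (suc (suc m)) (λ x → f x xor prefix k x)
    by-cases false f[P] =
      let k , k<2^m , h = even⇒prefix-coset m (fold (suc m) f) (fold-parity f[P])
      in k , <-trans k<2^m (2^<2^suc m) ,
         cong₂ _xor_ f[P] (prefix-beyond k P (*-monoʳ-< 2 k<2^m)) ,
         InHᶠ-cong (suc m) (fold-xor-prefix-below m f k k<2^m) h
    by-cases true f[P] =
      let k , k<2^m , h = even⇒prefix-coset m (λ x → fold (suc m) f x xor true)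
                            (trans (parity-complement m (fold (suc m) f)) (fold-parity f[P]))
          P≤2[2^m+k] = *-monoʳ-≤ 2 (m≤m+n (2 ^ m) k)
      in 2 ^ m + k , +-<-2^suc m k<2^m ,
         cong₂ _xor_ f[P] (cong₂ _∧_ (≤ᵇ-true (2^>0 (suc m))) (≤ᵇ-true P≤2[2^m+k])) ,
         InHᶠ-cong (suc m) (fold-xor-prefix-above m f k) h

<n/2⇒2*<n : j < n / 2 → 2 * j < n
<n/2⇒2*<n {j} {n} j<n/2 = <-≤-trans (*-monoʳ-< 2 j<n/2) (subst (_≤ n) (*-comm (n / 2) 2) (m/n*n≤m n 2))

2^suc/2 : ∀ m → 2 ^ suc m / 2 ≡ 2 ^ m
2^suc/2 m = trans (cong (_/ 2) (*-comm 2 (2 ^ m))) (m*n/n≡m (2 ^ m) 2)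

Hi-distinct : ∀ m i j → 1 ≤ i → i ≤ nOf m / 2 → 1 ≤ j → j ≤ nOf m / 2 →
  ¬ (i ≡ j) → ¬ SameSet m (Hi m i) (Hi m j)
Hi-distinct m (suc i) (suc j) _ i<n/2 _ j<n/2 i≢j with <-cmp i j
... | tri< i<j _ _ = prefix-cosets-distinct m i j i<j (<n/2⇒2*<n j<n/2)
... | tri≈ _ refl _ = ⊥-elim (i≢j refl)
... | tri> _ _ j<i = prefix-cosets-distinct m j i j<i (<n/2⇒2*<n i<n/2) ∘ λ same B → swap (same B)

∅-Δ : ∀ m B → _Δ_ m (∅ m) B ≡ B
∅-Δ m B = χ-injective m _ B (λ x _ _ → trans (χ-Δ m (∅ m) B x) (cong (_xor χ B x) (χ-∅ m x)))

∣interval-from-1∣ : ∀ m t → t ≤ 2 ^ m ∸ 1 → ∣ interval m 1 t ∣ ≡ t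
∣interval-from-1∣ m = go (2 ^ m ∸ 1)
  where
    go : ∀ N t → t ≤ N → ∣ tabulate {n = N} (λ k → toℕ k <ᵇ t) ∣ ≡ t
    go zero    zero    _        = refl
    go (suc N) zero    _        = go N zero z≤n
    go (suc N) (suc t) (s≤s t≤N) = cong suc (go N t t≤N)

Hi-coset : ∀ m i → 1 ≤ i → i ≤ nOf m / 2 →
  Σ (Ground m) λ c → InG m c × SameSet m (Hi m i) (Coset m c)
Hi-coset m (suc zero)    _ _ =
  ∅ m , cong (_% 2) (∣⊥∣≡0 (2 ^ m ∸ 1)) ,
  λ B → (λ B∈H → B , B∈H , sym (∅-Δ m B)) ,
        λ { (h , h∈H , refl) → subst (InH m) (sym (∅-Δ m h)) h∈H }
Hi-coset m (suc (suc k)) _ i<n/2 =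
  interval m 1 (2 * suc k) ,
  trans (cong (_% 2) (trans (∣interval-from-1∣ m (2 * suc k) (<⇒≤∸1 (<n/2⇒2*<n {n = 2 ^ m} i<n/2)))
                            (*-comm 2 (suc k))))
        (m*n%n≡0 (suc k) 2) ,
  λ B → (λ B∈Hi → B∈Hi) , (λ B∈cH → B∈cH)

coset-Hi : ∀ m (c : Ground (suc m)) → InG (suc m) c →
  Σ ℕ λ i → (1 ≤ i) × (i ≤ nOf (suc m) / 2) × SameSet (suc m) (Coset (suc m) c) (Hi (suc m) i)
coset-Hi m c c-even with even⇒prefix-coset m (χ c) (InG⇒parity-even (suc m) c c-even)
... | k , k<2^m , c+prefix∈H =
  suc k , s≤s z≤n , subst (suc k ≤_) (sym (2^suc/2 m)) k<2^m ,
  λ B → (InCosetᶠ⇒Hi M k B ∘ InCosetᶠ-move M (χ c) (prefix k) B c+prefix∈H ∘ Coset⇒InCosetᶠ M c) ,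
        (InCosetᶠ⇒Coset M c ∘ InCosetᶠ-move M (prefix k) (χ c) B prefix+c∈H ∘ Hi⇒InCosetᶠ M k B)
  where
    M = suc m
    prefix+c∈H : InHᶠ M (λ x → prefix k x xor χ c x)
    prefix+c∈H = InHᶠ-cong M (λ x _ _ → xor-comm (χ c x) (prefix k x)) c+prefix∈H

-- The hypothesis 2 ≤ m is used only to exclude m = 0, where there is no H_i.
lemma2p3 : (m : ℕ) → 2 ≤ m →
    -- (1) no nonempty element of H is a set of consecutive integers
    ((B : Ground m) → InH m B → ¬ (B ≡ ∅ m) → ¬ (Σ ℕ λ a → Σ ℕ λ b → B ≡ interval m a b))
    -- and |H| = 2^(n-m-1)
    × HasCard m (InH m) (2 ^ (nOf m ∸ m ∸ 1))
    -- (2) the H_i (1 ≤ i ≤ n/2) are pairwise distinct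
    × ((i j : ℕ) → 1 ≤ i → i ≤ nOf m / 2 → 1 ≤ j → j ≤ nOf m / 2 →
         ¬ (i ≡ j) → ¬ SameSet m (Hi m i) (Hi m j))
    -- each H_i is a coset of H in G
    × ((i : ℕ) → 1 ≤ i → i ≤ nOf m / 2 →
         Σ (Ground m) λ c → InG m c × SameSet m (Hi m i) (Coset m c))
    -- every coset of H in G is some H_i
    × ((c : Ground m) → InG m c →
         Σ ℕ λ i → (1 ≤ i) × (i ≤ nOf m / 2) × SameSet m (Coset m c) (Hi m i))
lemma2p3 (suc m) _ =
  nonempty-interval∉H (suc m) , H-card (suc m) , Hi-distinct (suc m) , Hi-coset (suc m) , coset-Hi m
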